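{- Let $H=(V,F,z)$ be a directed hypergraph with $n=|V|$ and let $\lambda$ be a positive integer. CoresetFinder$(H,\lambda)$ returns a set $S\subseteq F$ of at most $\lambda n^2$ hyperarcs that can be partitioned into disjoint subsets $\{S^{uv}:(u,v)\in C(F)\}$ satisfying: (1) for every $(u,v)\in C(F)$, every $f\in S^{uv}$ satisfies $(u,v)\in C(f)$; (2) if $(u,v)\in C(F\setminus S)$ then $|S^{uv}|=\lambda$; (3) for any $(u,v)\in C(F)$, $f\in S^{uv}$, and $f'\in F\setminus S$ with $(u,v)\in C(f')$, we have $z_f\ge z_{f'}$.
   Context: A directed hypergraph $H=(V,F,z)$: finite vertex set $V$, finite set $F$ of hyperarcs $f=(t(f),h(f))$ with $t(f),h(f)$ non-empty subsets of $V$, weights $z:F\to\mathbb{R}_{\ge0}$. The biclique of $f$ is $C(f)=\{(u,v):u\in t(f),v\in h(f)\}$ and $C(F')=\bigcup_{f\in F'}C(f)$. CoresetFinder$(H,\lambda)$: set $S=\emptyset$; for each $(u,v)\in C(F)$ in arbitrary order, let $A^{uv}=\{f\in F:(u,v)\in C(f)\}$; if $|A^{uv}\setminus S|\ge\lambda$, let $S^{uv}$ be the $\lambda$ heaviest hyperarcs of $A^{uv}\setminus S$ (ties broken by a fixed total order), otherwise $S^{uv}=A^{uv}\setminus S$; set $S\leftarrow S\cup S^{uv}$; finally return $S$.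
   Formalization: The hyperarc weights z are nonnegative rationals instead of nonnegative reals. -}

module Defs where

open import Data.Nat using (ℕ)
open import Data.Bool using (Bool; true; false; _∧_; _∨_; not)
open import Data.Fin using (Fin; toℕ)
open import Data.Fin.Subset using (Subset; _∈_; _∉_; _∪_; ⁅_⁆; ⊥; Nonempty)
open import Data.Fin.Subset.Properties using (_∈?_)
open import Data.List using (List; []; _∷_; filter; take; foldr; allFin)
open import Data.Product using (_×_; _,_; ∃; ∃₂)
open import Data.Rational using (ℚ; 0ℚ; _≤_)
open import Data.Rational.Properties using (_<?_; _≟_)
import Data.Nat.Properties as ℕP
open import Relation.Nullary using (¬_; does)
open import Relation.Nullary.Decidable using (_×-dec_; ¬?)

-- A directed hypergraph H = (V, F, z) with V = Fin n and F = Fin m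
-- (hyperarcs are labels; f has tail t f and head h f, both non-empty subsets of V,
-- and weight z f ≥ 0).  Real weights are represented by rationals.
record DHypergraph : Set where
  field
    n : ℕ
    m : ℕ
    t : Fin m → Subset n
    h : Fin m → Subset n
    z : Fin m → ℚ
    t-nonempty : ∀ f → Nonempty (t f)
    h-nonempty : ∀ f → Nonempty (h f)
    z-nonneg   : ∀ f → 0ℚ ≤ z f

module _ (H : DHypergraph) where
  open DHypergraph H

  InC : Fin n → Fin n → Fin m → Set
  InC u v f = (u ∈ t f) × (v ∈ h f)

  inC? : ∀ u v f → Bool
  inC? u v f = does ((u ∈? t f) ×-dec (v ∈? h f))

  InCSet : Subset m → Fin n → Fin n → Set
  InCSet F' u v = ∃ λ f → f ∈ F' × InC u v f

  InCF : Fin n → Fin n → Set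
  InCF u v = ∃ λ f → InC u v f

  better : Fin m → Fin m → Bool
  better f g = does (z g <? z f)
             ∨ (does (z f ≟ z g) ∧ does (toℕ f ℕP.<? toℕ g))

  insertDesc : Fin m → List (Fin m) → List (Fin m)
  insertDesc f [] = f ∷ []
  insertDesc f (g ∷ gs) with better f g
  ... | true  = f ∷ g ∷ gs
  ... | false = g ∷ insertDesc f gs

  sortDesc : List (Fin m) → List (Fin m)
  sortDesc = foldr insertDesc []

  toSubset : List (Fin m) → Subset m
  toSubset = foldr (λ f s → ⁅ f ⁆ ∪ s) ⊥

  candidates : Subset m → Fin n → Fin n → List (Fin m)
  candidates S u v = filter (λ f → ¬? (f ∈? S) ×-dec ((u ∈? t f) ×-dec (v ∈? h f))) (allFin m)

  Suv : ℕ → Subset m → Fin n → Fin n → Subset m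
  Suv λ' S u v = toSubset (take λ' (sortDesc (candidates S u v)))

  run : ℕ → List (Fin n × Fin n) → Subset m → Subset m
  run λ' [] S = S
  run λ' ((u , v) ∷ ps) S = run λ' ps (S ∪ Suv λ' S u v)

  CoresetFinder : ℕ → List (Fin n × Fin n) → Subset m
  CoresetFinder λ' ord = run λ' ord ⊥

{-# OPTIONS --safe #-}
-- For a pair (u , v), sorting the fresh candidates by weight and keeping the first λ yields
-- either all of them, or λ arcs none lighter than a candidate left out.  Because the list of
-- pairs is duplicate-free, every output arc was taken at exactly one pair, which gives the
-- partition.  An arc f′ ∉ S with (u , v) ∈ C(f′) was still a candidate when (u , v) was
-- processed and was not taken, so S^{uv} is in the second case.  Each of the at most n²
-- pairs adds at most λ arcs.
module Submission where

open import Defs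
open import Data.Nat using (ℕ; _*_; NonZero)
open import Data.Fin using (Fin)
open import Data.Fin.Subset using (Subset; _∈_; _∉_; ∣_∣; ∁)
open import Data.List using (List)
open import Data.List.Membership.Propositional using () renaming (_∈_ to _∈ₗ_)
open import Data.List.Relation.Unary.Unique.Propositional using (Unique)
open import Data.Product using (_×_; _,_; ∃; ∃₂; Σ)
open import Data.Rational using (_≤_)
open import Relation.Binary.PropositionalEquality using (_≡_; _≢_)
open import Relation.Nullary using (¬_)
open import Function.Bundles using (_⇔_)
import Data.Nat as ℕ

open import Data.Bool using (Bool; true; false; _∧_; _∨_; if_then_else_)
open import Data.Empty using (⊥-elim)
open import Data.Fin using (zero; suc; combine)
open import Data.Fin.Properties using (_≟_; combine-injective)
open import Data.Fin.Subset using (⁅_⁆; _∪_; _⊆_; ⊥; inside; outside)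
open import Data.Fin.Subset.Properties
  using (x∈p∪q⁺; x∈p∪q⁻; x∈⁅x⁆; x∈⁅y⁆⇒x≡y; ∉⊥; ∣⊥∣≡0; ∣p∣≤n; ∣p∣≤∣x∷p∣; ∪-identityˡ; x∈∁p⇒x∉p)
open import Data.List using ([]; _∷_; foldr; length; map; take; allFin)
open import Data.List.Properties using (length-map; length-take; take-all; take++drop≡id)
open import Data.List.Membership.Propositional.Properties
  using (∈-++⁺ˡ; ∈-filter⁺; ∈-filter⁻; ∈-allFin)
open import Data.List.Relation.Unary.Any using (here; there)
open import Data.List.Relation.Unary.All as All using ([]; _∷_)
open import Data.List.Relation.Unary.AllPairs using (AllPairs; []; _∷_)
open import Data.List.Relation.Unary.Unique.Propositional.Properties as Unique
  using (Unique[x∷xs]⇒x∉xs)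
open import Data.List.Relation.Binary.Permutation.Propositional
  using (_↭_; ↭-refl; ↭-prep; ↭-swap; ↭-trans; ↭-sym; ↭⇒↭ₛ)
open import Data.List.Relation.Binary.Permutation.Propositional.Properties
  using (∈-resp-↭; All-resp-↭)
open import Data.List.Relation.Binary.Permutation.Setoid.Properties using (Unique-resp-↭)
open import Data.Nat using (suc; _+_; _⊓_; z≤n; s≤s)
open import Data.Nat.Properties as ℕP using (_≤?_)
open import Data.Product using (uncurry; proj₁; proj₂)
open import Data.Product.Properties using (≡-dec)
open import Data.Rational using (_<_)
open import Data.Rational.Properties as ℚP using (_<?_; <⇒≤; ≮⇒≥)
open import Data.Sum using (_⊎_; inj₁; inj₂)
open import Data.Vec using ([]; _∷_; here; there)
open import Function using (_∘_; id)
open import Function.Bundles using (mk⇔; Equivalence)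
open import Relation.Binary.PropositionalEquality
  using (refl; sym; trans; cong; cong₂; subst; setoid; module ≡-Reasoning)
open import Relation.Nullary using (Dec; yes; no; does; contradiction)
open import Relation.Nullary.Decidable using (dec-true; dec-false)

private variable k : ℕ

fromList : List (Fin k) → Subset k
fromList = foldr (λ x s → ⁅ x ⁆ ∪ s) ⊥

∈-fromList⁺ : ∀ {x : Fin k} {xs} → x ∈ₗ xs → x ∈ fromList xs
∈-fromList⁺ (here refl) = x∈p∪q⁺ (inj₁ (x∈⁅x⁆ _))
∈-fromList⁺ (there x∈xs) = x∈p∪q⁺ (inj₂ (∈-fromList⁺ x∈xs))

∈-fromList⁻ : ∀ {x : Fin k} xs → x ∈ fromList xs → x ∈ₗ xs
∈-fromList⁻ [] x∈ = ⊥-elim (∉⊥ x∈)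
∈-fromList⁻ (y ∷ ys) x∈ with x∈p∪q⁻ ⁅ y ⁆ (fromList ys) x∈
... | inj₁ x∈⁅y⁆ = here (x∈⁅y⁆⇒x≡y y x∈⁅y⁆)
... | inj₂ x∈ys = there (∈-fromList⁻ ys x∈ys)

x∉p⇒∣⁅x⁆∪p∣≡1+∣p∣ : ∀ (x : Fin k) p → x ∉ p → ∣ ⁅ x ⁆ ∪ p ∣ ≡ suc ∣ p ∣
x∉p⇒∣⁅x⁆∪p∣≡1+∣p∣ zero (outside ∷ p) _ = cong (suc ∘ ∣_∣) (∪-identityˡ p)
x∉p⇒∣⁅x⁆∪p∣≡1+∣p∣ zero (inside ∷ p) x∉p = contradiction here x∉p
x∉p⇒∣⁅x⁆∪p∣≡1+∣p∣ (suc x) (inside ∷ p) x∉p = cong suc (x∉p⇒∣⁅x⁆∪p∣≡1+∣p∣ x p (x∉p ∘ there))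
x∉p⇒∣⁅x⁆∪p∣≡1+∣p∣ (suc x) (outside ∷ p) x∉p = x∉p⇒∣⁅x⁆∪p∣≡1+∣p∣ x p (x∉p ∘ there)

∣fromList∣≡length : (xs : List (Fin k)) → Unique xs → ∣ fromList xs ∣ ≡ length xs
∣fromList∣≡length {k} [] _ = ∣⊥∣≡0 k
∣fromList∣≡length (x ∷ xs) x∷xs!@(_ ∷ xs!) = begin
  ∣ ⁅ x ⁆ ∪ fromList xs ∣  ≡⟨ x∉p⇒∣⁅x⁆∪p∣≡1+∣p∣ x _ (Unique[x∷xs]⇒x∉xs x∷xs! ∘ ∈-fromList⁻ xs) ⟩
  suc ∣ fromList xs ∣      ≡⟨ cong suc (∣fromList∣≡length xs xs!) ⟩
  suc (length xs)          ∎
  where open ≡-Reasoning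

Unique⇒length≤ : (xs : List (Fin k)) → Unique xs → length xs ℕ.≤ k
Unique⇒length≤ xs xs! = subst (ℕ._≤ _) (∣fromList∣≡length xs xs!) (∣p∣≤n (fromList xs))

∣p∪q∣≤∣p∣+∣q∣ : (p q : Subset k) → ∣ p ∪ q ∣ ℕ.≤ ∣ p ∣ + ∣ q ∣
∣p∪q∣≤∣p∣+∣q∣ [] [] = z≤n
∣p∪q∣≤∣p∣+∣q∣ (inside ∷ p) (b ∷ q) =
  s≤s (ℕP.≤-trans (∣p∪q∣≤∣p∣+∣q∣ p q) (ℕP.+-monoʳ-≤ ∣ p ∣ (∣p∣≤∣x∷p∣ b q)))
∣p∪q∣≤∣p∣+∣q∣ (outside ∷ p) (inside ∷ q) =
  subst (ℕ._≤_ _) (sym (ℕP.+-suc ∣ p ∣ ∣ q ∣)) (s≤s (∣p∪q∣≤∣p∣+∣q∣ p q))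
∣p∪q∣≤∣p∣+∣q∣ (outside ∷ p) (outside ∷ q) = ∣p∪q∣≤∣p∣+∣q∣ p q

Unique⇒length≤* : ∀ {a b} (ps : List (Fin a × Fin b)) → Unique ps → length ps ℕ.≤ a * b
Unique⇒length≤* ps ps! = subst (ℕ._≤ _) (length-map code ps)
  (Unique⇒length≤ (map code ps) (Unique.map⁺ code-injective ps!))
  where
  code = uncurry combine
  code-injective : ∀ {p q} → code p ≡ code q → p ≡ q
  code-injective {i , j} {i′ , j′} eq = uncurry (cong₂ _,_) (combine-injective i j i′ j′ eq)

∈-take⇒∈ : ∀ {A : Set} {x : A} j xs → x ∈ₗ take j xs → x ∈ₗ xs
∈-take⇒∈ j xs x∈ = subst (_ ∈ₗ_) (take++drop≡id j xs) (∈-++⁺ˡ x∈)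

AllPairs-take⇒R : ∀ {A : Set} {R : A → A → Set} {x y : A} j xs → AllPairs R xs →
                x ∈ₗ take j xs → y ∈ₗ xs → ¬ y ∈ₗ take j xs → R x y
AllPairs-take⇒R (suc j) (a ∷ xs) (Ra ∷ _) (here refl) (there y∈) _ = All.lookup Ra y∈
AllPairs-take⇒R (suc j) (a ∷ xs) _ _ (here refl) y∉ = contradiction (here refl) y∉
AllPairs-take⇒R (suc j) (a ∷ xs) (_ ∷ R*) (there x∈) (there y∈) y∉ =
  AllPairs-take⇒R j xs R* x∈ y∈ (y∉ ∘ there)

module Sorting (H : DHypergraph) where
  open DHypergraph H

  better⇒≥ : ∀ f g → better H f g ≡ true → z g ≤ z f
  better⇒≥ f g = by-cases (z g <? z f) (z f ℚP.≟ z g) _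
    where
    by-cases : (g<f : Dec (z g < z f)) (f≡g : Dec (z f ≡ z g)) (tie : Bool) →
               does g<f ∨ (does f≡g ∧ tie) ≡ true → z g ≤ z f
    by-cases (yes g<f) _         _ _ = <⇒≤ g<f
    by-cases (no _)    (yes f≡g) _ _ = ℚP.≤-reflexive (sym f≡g)
    by-cases (no _)    (no _)    _ ()

  ¬better⇒≤ : ∀ f g → better H f g ≡ false → z f ≤ z g
  ¬better⇒≤ f g = by-cases (z g <? z f) _
    where
    by-cases : (g<f : Dec (z g < z f)) (tie : Bool) → does g<f ∨ tie ≡ false → z f ≤ z g
    by-cases (no g≮f) _ _ = ≮⇒≥ g≮f

  insertDesc-↭ : ∀ f gs → insertDesc H f gs ↭ f ∷ gs
  insertDesc-↭ f [] = ↭-refl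
  insertDesc-↭ f (g ∷ gs) with better H f g
  ... | true  = ↭-refl
  ... | false = ↭-trans (↭-prep g (insertDesc-↭ f gs)) (↭-swap g f ↭-refl)

  sortDesc-↭ : ∀ gs → sortDesc H gs ↭ gs
  sortDesc-↭ [] = ↭-refl
  sortDesc-↭ (g ∷ gs) = ↭-trans (insertDesc-↭ g (sortDesc H gs)) (↭-prep g (sortDesc-↭ gs))

  Descending : List (Fin m) → Set
  Descending = AllPairs (λ f g → z g ≤ z f)

  insertDesc-descending : ∀ f gs → Descending gs → Descending (insertDesc H f gs)
  insertDesc-descending f [] [] = [] ∷ []
  insertDesc-descending f (g ∷ gs) (g≥gs ∷ gs↓) with better H f g in f≻g
  ... | true  = (f≥g ∷ All.map (λ g≥h → ℚP.≤-trans g≥h f≥g) g≥gs) ∷ g≥gs ∷ gs↓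
    where f≥g = better⇒≥ f g f≻g
  ... | false = All-resp-↭ (↭-sym (insertDesc-↭ f gs)) (¬better⇒≤ f g f≻g ∷ g≥gs)
              ∷ insertDesc-descending f gs gs↓

  sortDesc-descending : ∀ gs → Descending (sortDesc H gs)
  sortDesc-descending [] = []
  sortDesc-descending (g ∷ gs) = insertDesc-descending g (sortDesc H gs) (sortDesc-descending gs)

module Selection (H : DHypergraph) (λ' : ℕ) where
  open DHypergraph H
  open Sorting H

  ranked : Subset m → Fin n → Fin n → List (Fin m)
  ranked S u v = sortDesc H (candidates H S u v)

  ∈-ranked⁺ : ∀ {S u v f} → f ∉ S → InC H u v f → f ∈ₗ ranked S u v
  ∈-ranked⁺ {f = f} f∉S uv∈Cf =
    ∈-resp-↭ (↭-sym (sortDesc-↭ _)) (∈-filter⁺ _ (∈-allFin f) (f∉S , uv∈Cf))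

  ∈-ranked⁻ : ∀ {S u v f} → f ∈ₗ ranked S u v → f ∉ S × InC H u v f
  ∈-ranked⁻ f∈ = proj₂ (∈-filter⁻ _ {xs = allFin m} (∈-resp-↭ (sortDesc-↭ _) f∈))

  ranked-unique : ∀ S u v → Unique (ranked S u v)
  ranked-unique S u v =
    Unique-resp-↭ (setoid (Fin m)) (↭⇒↭ₛ (↭-sym (sortDesc-↭ (candidates H S u v))))
                  (Unique.filter⁺ _ (Unique.allFin⁺ m))

  -- `toSubset H` is `fromList`, so `Suv H λ' S u v` unfolds to `fromList (take λ' (ranked S u v))`.
  Suv-fresh : ∀ {S u v f} → f ∈ Suv H λ' S u v → f ∉ S × InC H u v f
  Suv-fresh {S} {u} {v} f∈ = ∈-ranked⁻ (∈-take⇒∈ λ' (ranked S u v) (∈-fromList⁻ _ f∈))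

  ∣Suv∣≡λ⊓∣ranked∣ : ∀ S u v → ∣ Suv H λ' S u v ∣ ≡ λ' ⊓ length (ranked S u v)
  ∣Suv∣≡λ⊓∣ranked∣ S u v = trans
    (∣fromList∣≡length _ (Unique.take⁺ λ' (ranked-unique S u v)))
    (length-take λ' (ranked S u v))

  ∣Suv∣≤λ : ∀ S u v → ∣ Suv H λ' S u v ∣ ℕ.≤ λ'
  ∣Suv∣≤λ S u v = subst (ℕ._≤ λ') (sym (∣Suv∣≡λ⊓∣ranked∣ S u v)) (ℕP.m⊓n≤m λ' _)

  Suv-saturated : ∀ {S u v f′} → f′ ∉ S → InC H u v f′ → f′ ∉ Suv H λ' S u v →
                  ∣ Suv H λ' S u v ∣ ≡ λ' × (∀ {f} → f ∈ Suv H λ' S u v → z f′ ≤ z f)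
  Suv-saturated {S} {u} {v} {f′} f′∉S uv∈Cf′ f′∉Suv = full , heavier
    where
    f′∈ranked = ∈-ranked⁺ f′∉S uv∈Cf′
    f′∉top : ¬ f′ ∈ₗ take λ' (ranked S u v)
    f′∉top = f′∉Suv ∘ ∈-fromList⁺
    full : ∣ Suv H λ' S u v ∣ ≡ λ'
    full with λ' ≤? length (ranked S u v)
    ... | yes λ≤ = trans (∣Suv∣≡λ⊓∣ranked∣ S u v) (ℕP.m≤n⇒m⊓n≡m λ≤)
    ... | no λ≰ = contradiction (subst (f′ ∈ₗ_) (sym (take-all λ' _ (ℕP.≰⇒≥ λ≰))) f′∈ranked) f′∉top
    heavier : ∀ {f} → f ∈ Suv H λ' S u v → z f′ ≤ z f
    heavier f∈ = AllPairs-take⇒R λ' (ranked S u v) (sortDesc-descending (candidates H S u v))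
                                 (∈-fromList⁻ _ f∈) f′∈ranked f′∉top

module Partition (H : DHypergraph) (λ' : ℕ) where
  open DHypergraph H
  open Selection H λ'

  _≟²_ : (p q : Fin n × Fin n) → Dec (p ≡ q)
  _≟²_ = ≡-dec _≟_ _≟_

  -- `part ord ⊥ u v` is the paper's S^{uv}: the arcs taken when (u , v) is processed.
  part : List (Fin n × Fin n) → Subset m → Fin n → Fin n → Subset m
  part [] S u v = ⊥
  part ((a , b) ∷ ps) S u v =
    if does ((u , v) ≟² (a , b)) then Suv H λ' S a b else part ps (S ∪ Suv H λ' S a b) u v

  part-here : ∀ a b ps S → part ((a , b) ∷ ps) S a b ≡ Suv H λ' S a b
  part-here a b ps S rewrite dec-true ((a , b) ≟² (a , b)) refl = refl

  part-there : ∀ {a b u v} ps S → (u , v) ≢ (a , b) →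
               part ((a , b) ∷ ps) S u v ≡ part ps (S ∪ Suv H λ' S a b) u v
  part-there {a} {b} {u} {v} ps S uv≢ab rewrite dec-false ((u , v) ≟² (a , b)) uv≢ab = refl

  ⊆-run : ∀ ps S → S ⊆ run H λ' ps S
  ⊆-run [] S = id
  ⊆-run ((a , b) ∷ ps) S = ⊆-run ps _ ∘ x∈p∪q⁺ ∘ inj₁

  part-fresh : ∀ ps S u v {f} → f ∈ part ps S u v → f ∉ S
  part-fresh [] S u v f∈ = λ _ → ∉⊥ f∈
  part-fresh ((a , b) ∷ ps) S u v f∈ with (u , v) ≟² (a , b)
  ... | yes refl = proj₁ (Suv-fresh f∈)
  ... | no _     = part-fresh ps _ u v f∈ ∘ x∈p∪q⁺ ∘ inj₁

  part-InC : ∀ ps S u v {f} → f ∈ part ps S u v → InC H u v f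
  part-InC [] S u v f∈ = ⊥-elim (∉⊥ f∈)
  part-InC ((a , b) ∷ ps) S u v f∈ with (u , v) ≟² (a , b)
  ... | yes refl = proj₂ (Suv-fresh f∈)
  ... | no _     = part-InC ps _ u v f∈

  part-listed : ∀ ps S u v {f} → f ∈ part ps S u v → (u , v) ∈ₗ ps
  part-listed [] S u v f∈ = ⊥-elim (∉⊥ f∈)
  part-listed ((a , b) ∷ ps) S u v f∈ with (u , v) ≟² (a , b)
  ... | yes uv≡ab = here uv≡ab
  ... | no _      = there (part-listed ps _ u v f∈)

  part⊆run : ∀ ps S u v → part ps S u v ⊆ run H λ' ps S
  part⊆run [] S u v f∈ = ⊥-elim (∉⊥ f∈)
  part⊆run ((a , b) ∷ ps) S u v f∈ with (u , v) ≟² (a , b)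
  ... | yes _ = ⊆-run ps _ (x∈p∪q⁺ (inj₂ f∈))
  ... | no _  = part⊆run ps _ u v f∈

  run⊆S∪parts : ∀ ps S → Unique ps → ∀ {f} → f ∈ run H λ' ps S →
                f ∈ S ⊎ ∃₂ λ u v → f ∈ part ps S u v
  run⊆S∪parts [] S _ f∈ = inj₁ f∈
  run⊆S∪parts ((a , b) ∷ ps) S ps!@(_ ∷ tail!) f∈ with run⊆S∪parts ps _ tail! f∈
  ... | inj₂ (u , v , f∈part) = inj₂ (u , v , subst (_ ∈_) (sym (part-there ps S uv≢ab)) f∈part)
    where
    uv≢ab : (u , v) ≢ (a , b)
    uv≢ab refl = Unique[x∷xs]⇒x∉xs ps! (part-listed ps _ u v f∈part)
  ... | inj₁ f∈S∪ with x∈p∪q⁻ S _ f∈S∪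
  ...   | inj₁ f∈S = inj₁ f∈S
  ...   | inj₂ f∈Suv = inj₂ (a , b , subst (_ ∈_) (sym (part-here a b ps S)) f∈Suv)

  part-disjoint : ∀ ps S u v u′ v′ → (u , v) ≢ (u′ , v′) →
                  ∀ {f} → f ∈ part ps S u v → f ∉ part ps S u′ v′
  part-disjoint [] S u v u′ v′ _ f∈ _ = ∉⊥ f∈
  part-disjoint ((a , b) ∷ ps) S u v u′ v′ uv≢u′v′ f∈ f∈′
    with (u , v) ≟² (a , b) | (u′ , v′) ≟² (a , b)
  ... | yes refl | yes refl = uv≢u′v′ refl
  ... | yes refl | no _     = part-fresh ps _ u′ v′ f∈′ (x∈p∪q⁺ (inj₂ f∈))
  ... | no _     | yes refl = part-fresh ps _ u v f∈ (x∈p∪q⁺ (inj₂ f∈′))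
  ... | no _     | no _     = part-disjoint ps _ u v u′ v′ uv≢u′v′ f∈ f∈′

  part-saturated : ∀ ps S u v → (u , v) ∈ₗ ps → ∀ {f′} → f′ ∉ run H λ' ps S → InC H u v f′ →
                   ∣ part ps S u v ∣ ≡ λ' × (∀ {f} → f ∈ part ps S u v → z f′ ≤ z f)
  part-saturated ((a , b) ∷ ps) S u v uv∈ f′∉run uv∈Cf′ with (u , v) ≟² (a , b) | uv∈
  ... | yes refl | _ = Suv-saturated (f′∉run ∘ ⊆-run ps _ ∘ x∈p∪q⁺ ∘ inj₁) uv∈Cf′
                                     (f′∉run ∘ ⊆-run ps _ ∘ x∈p∪q⁺ ∘ inj₂)
  ... | no uv≢ab | here uv≡ab = contradiction uv≡ab uv≢ab
  ... | no _     | there uv∈ps = part-saturated ps _ u v uv∈ps f′∉run uv∈Cf′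

  ∣run∣≤ : ∀ ps S → ∣ run H λ' ps S ∣ ℕ.≤ ∣ S ∣ + λ' * length ps
  ∣run∣≤ [] S = ℕP.m≤m+n ∣ S ∣ _
  ∣run∣≤ ((a , b) ∷ ps) S = begin
    ∣ run H λ' ps S′ ∣                          ≤⟨ ∣run∣≤ ps S′ ⟩
    ∣ S′ ∣ + λ' * length ps                     ≤⟨ ℕP.+-monoˡ-≤ _ (∣p∪q∣≤∣p∣+∣q∣ S _) ⟩
    ∣ S ∣ + ∣ Suv H λ' S a b ∣ + λ' * length ps
      ≤⟨ ℕP.+-monoˡ-≤ _ (ℕP.+-monoʳ-≤ ∣ S ∣ (∣Suv∣≤λ S a b)) ⟩
    ∣ S ∣ + λ' + λ' * length ps                 ≡⟨ ℕP.+-assoc ∣ S ∣ λ' _ ⟩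
    ∣ S ∣ + (λ' + λ' * length ps)               ≡⟨ cong (∣ S ∣ +_) (ℕP.*-suc λ' (length ps)) ⟨
    ∣ S ∣ + λ' * suc (length ps)                ∎
    where
    open ℕP.≤-Reasoning
    S′ = S ∪ Suv H λ' S a b

mainTheorem8 : (H : DHypergraph) → let open DHypergraph H in
  (λ' : ℕ) → .{{_ : NonZero λ'}} →
  (ord : List (Fin n × Fin n)) → Unique ord → (∀ u v → ((u , v) ∈ₗ ord) ⇔ InCF H u v) →
  let S = CoresetFinder H λ' ord in
  (∣ S ∣ ℕ.≤ λ' * (n * n)) ×
  (Σ (Fin n → Fin n → Subset m) λ P →
    (∀ f → (f ∈ S) ⇔ (∃₂ λ u v → InCF H u v × f ∈ P u v)) ×
    (∀ u v u' v' → InCF H u v → InCF H u' v' → (u , v) ≢ (u' , v') →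
       ∀ f → f ∈ P u v → f ∉ P u' v') ×
    (∀ u v → InCF H u v → ∀ f → f ∈ P u v → InC H u v f) ×
    (∀ u v → InCSet H (∁ S) u v → ∣ P u v ∣ ≡ λ') ×
    (∀ u v → InCF H u v → ∀ f → f ∈ P u v → ∀ f' → f' ∉ S → InC H u v f' → z f' ≤ z f))
mainTheorem8 H λ' ord ord! ord⇔C =
  size , P , covers , (λ u v u′ v′ _ _ uv≢ → λ _ → part-disjoint ord ⊥ u v u′ v′ uv≢) ,
  (λ u v _ _ → part-InC ord ⊥ u v) ,
  (λ { u v (f′ , f′∉S , uv∈Cf′) → proj₁ (saturated u v (f′ , uv∈Cf′) (x∈∁p⇒x∉p f′∉S) uv∈Cf′) }) ,
  (λ u v uv∈CF f f∈ f′ f′∉S uv∈Cf′ → proj₂ (saturated u v uv∈CF f′∉S uv∈Cf′) f∈)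
  where
  open DHypergraph H
  open Partition H λ'
  S = CoresetFinder H λ' ord
  P = part ord ⊥

  saturated : ∀ u v → InCF H u v → ∀ {f′} → f′ ∉ S → InC H u v f′ →
              ∣ P u v ∣ ≡ λ' × (∀ {f} → f ∈ P u v → z f′ ≤ z f)
  saturated u v uv∈CF = part-saturated ord ⊥ u v (Equivalence.from (ord⇔C u v) uv∈CF)

  size : ∣ S ∣ ℕ.≤ λ' * (n * n)
  size = begin
    ∣ S ∣                          ≤⟨ ∣run∣≤ ord ⊥ ⟩
    ∣ ⊥ {n = m} ∣ + λ' * length ord ≡⟨ cong (_+ λ' * length ord) (∣⊥∣≡0 m) ⟩
    λ' * length ord                ≤⟨ ℕP.*-monoʳ-≤ λ' (Unique⇒length≤* ord ord!) ⟩
    λ' * (n * n)                   ∎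
    where open ℕP.≤-Reasoning

  covers : ∀ f → (f ∈ S) ⇔ (∃₂ λ u v → InCF H u v × f ∈ P u v)
  covers f = mk⇔ to (λ (u , v , _ , f∈) → part⊆run ord ⊥ u v f∈)
    where
    to : f ∈ S → ∃₂ λ u v → InCF H u v × f ∈ P u v
    to f∈S with run⊆S∪parts ord ⊥ ord! f∈S
    ... | inj₁ f∈⊥ = ⊥-elim (∉⊥ f∈⊥)
    ... | inj₂ (u , v , f∈) = u , v , Equivalence.to (ord⇔C u v) (part-listed ord ⊥ u v f∈) , f∈
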